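{- Let $(E,f)$ be a polymatroid and let $g(A)=2f(E)f(A)-f(A)^2$ for $A\subseteq E$. Every flat of $g$ is inseparable (with respect to $g$).
   Context: Polymatroid: $f:2^E\to\mathbb{R}_{\ge0}$, $f(\emptyset)=0$, $f(A)\le f(A\cup B)\le f(A)+f(B)-f(A\cap B)$; $g$ is again a polymatroid. A flat of $g$ is $F\subseteq E$ with $g(F\cup\{e\})>g(F)$ for all $e\notin F$. A flat $F$ of $g$ is separable if $F=F_1\cup F_2$ for two disjoint nonempty flats $F_1,F_2$ of $g$ with $g(F)=g(F_1)+g(F_2)$, and inseparable otherwise. -}

module Defs where

open import Level using (Level; _⊔_) renaming (suc to lsuc)
open import Data.Nat using (ℕ)
open import Data.Product using (Σ; ∃; _×_; _,_)
open import Data.Fin using (Fin)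
open import Data.Fin.Subset using (Subset; _∪_; _∩_; ⁅_⁆; _∉_; Nonempty) renaming (⊥ to ∅; ⊤ to Full)
open import Relation.Nullary using (¬_)
open import Relation.Binary.Core using (Rel)
open import Relation.Binary.Structures using (IsTotalOrder)
open import Relation.Binary.PropositionalEquality using (_≡_)
open import Algebra.Bundles using (CommutativeRing)

record OrderedField (c ℓ₁ ℓ₂ : Level) : Set (lsuc (c ⊔ ℓ₁ ⊔ ℓ₂)) where
  field
    commutativeRing : CommutativeRing c ℓ₁
  open CommutativeRing commutativeRing public
  field
    _≤_          : Rel Carrier ℓ₂
    isTotalOrder : IsTotalOrder _≈_ _≤_
    +-mono-≤     : ∀ {x y} z → x ≤ y → (x + z) ≤ (y + z)
    *-nonneg     : ∀ {x y} → 0# ≤ x → 0# ≤ y → 0# ≤ (x * y)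
    0≉1          : ¬ (0# ≈ 1#)
    inverse      : ∀ x → ¬ (x ≈ 0#) → ∃ λ y → (x * y) ≈ 1#

  _<_ : Rel Carrier (ℓ₁ ⊔ ℓ₂)
  x < y = (x ≤ y) × ¬ (x ≈ y)

  2# : Carrier
  2# = 1# + 1#

module _ {c ℓ₁ ℓ₂ : Level} (K : OrderedField c ℓ₁ ℓ₂) {n : ℕ} where
  open OrderedField K

  record IsPolymatroid (f : Subset n → Carrier) : Set (ℓ₁ ⊔ ℓ₂) where
    field
      nonneg    : ∀ A → 0# ≤ f A
      empty     : f ∅ ≈ 0#
      monotone  : ∀ A B → f A ≤ f (A ∪ B)
      submod    : ∀ A B → f (A ∪ B) ≤ ((f A + f B) - f (A ∩ B))

  IsFlat : (Subset n → Carrier) → Subset n → Set (ℓ₁ ⊔ ℓ₂)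
  IsFlat g F = ∀ (e : Fin n) → e ∉ F → g F < g (F ∪ ⁅ e ⁆)

  Disjoint : Subset n → Subset n → Set
  Disjoint A B = (A ∩ B) ≡ ∅

  IsSeparable : (Subset n → Carrier) → Subset n → Set (ℓ₁ ⊔ ℓ₂)
  IsSeparable g F = IsFlat g F × Σ (Subset n) λ F₁ → Σ (Subset n) λ F₂ →
    Nonempty F₁ × Nonempty F₂ × Disjoint F₁ F₂ × IsFlat g F₁ × IsFlat g F₂ ×
    (F ≡ (F₁ ∪ F₂)) × (g F ≈ (g F₁ + g F₂))

  IsInseparable : (Subset n → Carrier) → Subset n → Set (ℓ₁ ⊔ ℓ₂)
  IsInseparable g F = IsFlat g F × ¬ IsSeparable g F

  gOf : (Subset n → Carrier) → Subset n → Carrier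
  gOf f A = ((2# * f Full) * f A) - (f A * f A)

{-# OPTIONS --safe #-}
module Submission where

-- Write a = f(E), x = f(F₁ ∪ F₂) and xᵢ = f(Fᵢ), so that g(A) = 2a f(A) − f(A)².
-- Monotonicity and subadditivity of f give x₁, x₂ ≤ x ≤ x₁ + x₂ and x ≤ a, and
-- g(F₁) + g(F₂) − g(F₁ ∪ F₂) is x₁x₂ plus a sum of products of the nonnegative
-- numbers x₁ + x₂ − x, x − x₁, x − x₂ and a − x.  Hence g(F) = g(F₁) + g(F₂)
-- forces x₁x₂ = 0.  But adding an element of f-value 0 to a set does not change
-- g, so every nonempty set disjoint from a flat of g has positive f-value.

open import Defs
open import Level using (Level; _⊔_)
open import Data.Nat using (ℕ)
open import Data.Fin using (Fin)
open import Data.Fin.Subset using (Subset; _∪_; _∩_; _⊆_; ⁅_⁆; _∈_; _∉_; Nonempty) renaming (⊥ to ∅; ⊤ to Full)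
open import Data.Fin.Subset.Properties using (⊆-antisym; ⊆⊤; p⊆p∪q; q⊆p∪q; x∈p∪q⁻; x∈p∩q⁺; x∈⁅y⁆⇒x≡y; ∉⊥; ∩-comm)
open import Data.Product using (_,_; proj₂)
open import Data.Sum using ([_,_])
open import Relation.Nullary using (¬_)
open import Function using (id)
open import Relation.Binary.PropositionalEquality as ≡ using (_≡_; subst)
open import Relation.Binary.Structures using (IsTotalOrder)
import Algebra.Properties.AbelianGroup as AbelianGroupProperties
import Algebra.Solver.Ring.NaturalCoefficients.Default as NaturalSolver
import Relation.Binary.Reasoning.Setoid as SetoidReasoning

p⊆q⇒p∪q≡q : ∀ {n} {p q : Subset n} → p ⊆ q → p ∪ q ≡ q
p⊆q⇒p∪q≡q {p = p} {q} p⊆q =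
  ⊆-antisym (λ x∈p∪q → [ p⊆q , id ] (x∈p∪q⁻ p q x∈p∪q)) (q⊆p∪q p q)

x∈p⇒⁅x⁆⊆p : ∀ {n} {x : Fin n} {p : Subset n} → x ∈ p → ⁅ x ⁆ ⊆ p
x∈p⇒⁅x⁆⊆p x∈p y∈⁅x⁆ = subst (_∈ _) (≡.sym (x∈⁅y⁆⇒x≡y _ y∈⁅x⁆)) x∈p

p∩q≡∅⇒x∈p⇒x∉q : ∀ {n} {x : Fin n} {p q : Subset n} → p ∩ q ≡ ∅ → x ∈ p → x ∉ q
p∩q≡∅⇒x∈p⇒x∉q p∩q≡∅ x∈p x∈q = ∉⊥ (subst (_ ∈_) p∩q≡∅ (x∈p∩q⁺ (x∈p , x∈q)))

module OrderedFieldProperties {c ℓ₁ ℓ₂ : Level} (K : OrderedField c ℓ₁ ℓ₂) where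
  open OrderedField K renaming (_≤_ to infix 4 _≤_)
  open IsTotalOrder isTotalOrder using (antisym; ≤-respʳ-≈; ≤-respˡ-≈) renaming (trans to ≤-trans)
  open AbelianGroupProperties +-abelianGroup using ()
    renaming (∙-cancelˡ to +-cancelˡ; identityʳ-unique to +-identityʳ-unique)
  open NaturalSolver commutativeSemiring using (solve; _:=_; _:+_; _:*_; con)
  open SetoidReasoning setoid

  +-monoˡ-≤ : ∀ {x y} z → x ≤ y → z + x ≤ z + y
  +-monoˡ-≤ {x} {y} z x≤y = ≤-respˡ-≈ (+-comm x z) (≤-respʳ-≈ (+-comm y z) (+-mono-≤ z x≤y))

  x+[y-x]≈y : ∀ x y → x + (y - x) ≈ y
  x+[y-x]≈y x y = begin
    x + (y - x)    ≈⟨ +-comm x (y - x) ⟩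
    (y - x) + x    ≈⟨ +-assoc y (- x) x ⟩
    y + (- x + x)  ≈⟨ +-congˡ (-‿inverseˡ x) ⟩
    y + 0#         ≈⟨ +-identityʳ y ⟩
    y              ∎

  x≤y⇒0≤y-x : ∀ {x y} → x ≤ y → 0# ≤ y - x
  x≤y⇒0≤y-x {x} x≤y = ≤-respˡ-≈ (-‿inverseʳ x) (+-mono-≤ (- x) x≤y)

  0≤y⇒x-y≤x : ∀ {x y} → 0# ≤ y → x - y ≤ x
  0≤y⇒x-y≤x {x} {y} 0≤y = ≤-respˡ-≈ (+-identityʳ (x - y))
    (≤-respʳ-≈ (trans (+-comm (x - y) y) (x+[y-x]≈y y x)) (+-monoˡ-≤ (x - y) 0≤y))

  0≤x⇒0≤y⇒0≤x+y : ∀ {x y} → 0# ≤ x → 0# ≤ y → 0# ≤ x + y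
  0≤x⇒0≤y⇒0≤x+y {x} {y} 0≤x 0≤y =
    ≤-trans 0≤y (≤-respˡ-≈ (+-identityˡ y) (+-mono-≤ y 0≤x))

  0≤x⇒0≤y⇒x+y≈0⇒x≈0 : ∀ {x y} → 0# ≤ x → 0# ≤ y → x + y ≈ 0# → x ≈ 0#
  0≤x⇒0≤y⇒x+y≈0⇒x≈0 {x} {y} 0≤x 0≤y x+y≈0 =
    antisym (≤-respʳ-≈ x+y≈0 (≤-respˡ-≈ (+-identityʳ x) (+-monoˡ-≤ x 0≤y))) 0≤x

  x≉0⇒y≉0⇒x*y≉0 : ∀ {x y} → x ≉ 0# → y ≉ 0# → x * y ≉ 0#
  x≉0⇒y≉0⇒x*y≉0 {x} {y} x≉0 y≉0 xy≈0 with inverse x x≉0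
  ... | x⁻¹ , x*x⁻¹≈1 = y≉0 (begin
    y                ≈⟨ *-identityˡ y ⟨
    1# * y           ≈⟨ *-congʳ x*x⁻¹≈1 ⟨
    (x * x⁻¹) * y    ≈⟨ solve 3 (λ x x⁻¹ y → (x :* x⁻¹) :* y := x⁻¹ :* (x :* y)) refl x x⁻¹ y ⟩
    x⁻¹ * (x * y)    ≈⟨ *-congˡ xy≈0 ⟩
    x⁻¹ * 0#         ≈⟨ zeroʳ x⁻¹ ⟩
    0#               ∎)

  record Gap (x y : Carrier) : Set (c ⊔ ℓ₁ ⊔ ℓ₂) where
    field
      gap     : Carrier
      gap≥0   : 0# ≤ gap
      y≈x+gap : y ≈ x + gap

  x≤y⇒gap : ∀ {x y} → x ≤ y → Gap x y
  x≤y⇒gap {x} {y} x≤y = record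
    { gap = y - x ; gap≥0 = x≤y⇒0≤y-x x≤y ; y≈x+gap = sym (x+[y-x]≈y x y) }

  -- x₁, x₂ ≤ x ≤ x₁ + x₂ are the areas of two overlapping regions and their union:
  -- s is the overlap, q and p the parts of x₁ and x₂ outside it.
  record VennSplit (x₁ x₂ x : Carrier) : Set (c ⊔ ℓ₁ ⊔ ℓ₂) where
    field
      s p q      : Carrier
      s≥0        : 0# ≤ s
      p≥0        : 0# ≤ p
      q≥0        : 0# ≤ q
      x₁≈s+q     : x₁ ≈ s + q
      x₂≈s+p     : x₂ ≈ s + p
      x≈s+[p+q]  : x ≈ s + (p + q)

  vennSplit : ∀ {x₁ x₂ x} → x₁ ≤ x → x₂ ≤ x → x ≤ x₁ + x₂ → VennSplit x₁ x₂ x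
  vennSplit {x₁} {x₂} {x} x₁≤x x₂≤x x≤x₁+x₂ = record
    { s = s ; p = p ; q = q ; s≥0 = s≥0 ; p≥0 = p≥0 ; q≥0 = q≥0
    ; x₁≈s+q = x₁≈s+q ; x₂≈s+p = x₂≈s+p
    ; x≈s+[p+q] = trans x≈x₁+p (trans (+-congʳ x₁≈s+q)
        (solve 3 (λ s p q → (s :+ q) :+ p := s :+ (p :+ q)) refl s p q))
    }
    where
    open Gap (x≤y⇒gap x₁≤x) renaming (gap to p; gap≥0 to p≥0; y≈x+gap to x≈x₁+p)
    open Gap (x≤y⇒gap x₂≤x) renaming (gap to q; gap≥0 to q≥0; y≈x+gap to x≈x₂+q)
    open Gap (x≤y⇒gap x≤x₁+x₂) renaming (gap to s; gap≥0 to s≥0; y≈x+gap to x₁+x₂≈x+s)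

    x₁≈s+q : x₁ ≈ s + q
    x₁≈s+q = +-cancelˡ x₂ x₁ (s + q) (begin
      x₂ + x₁        ≈⟨ +-comm x₂ x₁ ⟩
      x₁ + x₂        ≈⟨ x₁+x₂≈x+s ⟩
      x + s          ≈⟨ +-congʳ x≈x₂+q ⟩
      (x₂ + q) + s   ≈⟨ solve 3 (λ x₂ q s → (x₂ :+ q) :+ s := x₂ :+ (s :+ q)) refl x₂ q s ⟩
      x₂ + (s + q)   ∎)

    x₂≈s+p : x₂ ≈ s + p
    x₂≈s+p = +-cancelˡ x₁ x₂ (s + p) (begin
      x₁ + x₂        ≈⟨ x₁+x₂≈x+s ⟩
      x + s          ≈⟨ +-congʳ x≈x₁+p ⟩
      (x₁ + p) + s   ≈⟨ solve 3 (λ x₁ p s → (x₁ :+ p) :+ s := x₁ :+ (s :+ p)) refl x₁ p s ⟩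
      x₁ + (s + p)   ∎)

  -- gOf K f A unfolds to parabola (f Full) (f A).
  parabola : Carrier → Carrier → Carrier
  parabola a t = (2# * a) * t - t * t

  parabola-cong : ∀ {a a′ t t′} → a ≈ a′ → t ≈ t′ → parabola a t ≈ parabola a′ t′
  parabola-cong a≈a′ t≈t′ =
    +-cong (*-cong (*-congˡ a≈a′) t≈t′) (-‿cong (*-cong t≈t′ t≈t′))

  parabola+square : ∀ a t → parabola a t + t * t ≈ (2# * a) * t
  parabola+square a t = trans (+-comm (parabola a t) (t * t)) (x+[y-x]≈y (t * t) ((2# * a) * t))

  parabola-split⇒2ax₁+2ax₂+x²≈2ax+x₁²+x₂² : ∀ a x x₁ x₂ →
    parabola a x ≈ parabola a x₁ + parabola a x₂ →
    ((2# * a) * x₁ + (2# * a) * x₂) + x * x ≈ ((2# * a) * x + x₁ * x₁) + x₂ * x₂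
  parabola-split⇒2ax₁+2ax₂+x²≈2ax+x₁²+x₂² a x x₁ x₂ split = begin
    (b * x₁ + b * x₂) + x * x
      ≈⟨ +-congʳ (+-cong (parabola+square a x₁) (parabola+square a x₂)) ⟨
    ((g₁ + x₁ * x₁) + (g₂ + x₂ * x₂)) + x * x
      ≈⟨ solve 5 (λ g₁ g₂ y₁ y₂ y → ((g₁ :+ y₁) :+ (g₂ :+ y₂)) :+ y := ((g₁ :+ g₂) :+ y :+ y₁) :+ y₂)
           refl g₁ g₂ (x₁ * x₁) (x₂ * x₂) (x * x) ⟩
    (((g₁ + g₂) + x * x) + x₁ * x₁) + x₂ * x₂
      ≈⟨ +-congʳ (+-congʳ (+-congʳ split)) ⟨
    ((parabola a x + x * x) + x₁ * x₁) + x₂ * x₂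
      ≈⟨ +-congʳ (+-congʳ (parabola+square a x)) ⟩
    (b * x + x₁ * x₁) + x₂ * x₂ ∎
    where
    b = 2# * a
    g₁ = parabola a x₁
    g₂ = parabola a x₂

  parabola-split-defect : ∀ s p q u →
    let x₁ = s + q ; x₂ = s + p ; x = s + (p + q) ; b = 2# * (x + u) in
    (b * x₁ + b * x₂) + x * x
      ≈ ((b * x + x₁ * x₁) + x₂ * x₂) + (x₁ * x₂ + (((s * p + s * q) + p * q) + (u + u) * s))
  parabola-split-defect = solve 4 (λ s p q u →
    let x₁ = s :+ q ; x₂ = s :+ p ; x = s :+ (p :+ q) ; b = con 2 :* (x :+ u) in
    (b :* x₁ :+ b :* x₂) :+ x :* x
      := ((b :* x :+ x₁ :* x₁) :+ x₂ :* x₂) :+ (x₁ :* x₂ :+ (((s :* p :+ s :* q) :+ p :* q) :+ (u :+ u) :* s)))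
    refl

  parabola-split⇒*≈0 : ∀ {a x x₁ x₂} → x₁ ≤ x → x₂ ≤ x → x ≤ x₁ + x₂ → x ≤ a →
    parabola a x ≈ parabola a x₁ + parabola a x₂ → x₁ * x₂ ≈ 0#
  parabola-split⇒*≈0 {a} {x} {x₁} {x₂} x₁≤x x₂≤x x≤x₁+x₂ x≤a split =
    trans (*-cong x₁≈s+q x₂≈s+p) (0≤x⇒0≤y⇒x+y≈0⇒x≈0 (*-nonneg y₁≥0 y₂≥0) cross-terms≥0 defect≈0)
    where
    open VennSplit (vennSplit x₁≤x x₂≤x x≤x₁+x₂)
    open Gap (x≤y⇒gap x≤a) renaming (gap to u; gap≥0 to u≥0; y≈x+gap to a≈x+u)
    y₁ = s + q
    y₂ = s + p
    y = s + (p + q)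
    a′ = y + u
    cross-terms = ((s * p + s * q) + p * q) + (u + u) * s

    y₁≥0 : 0# ≤ y₁
    y₁≥0 = 0≤x⇒0≤y⇒0≤x+y s≥0 q≥0
    y₂≥0 : 0# ≤ y₂
    y₂≥0 = 0≤x⇒0≤y⇒0≤x+y s≥0 p≥0
    cross-terms≥0 : 0# ≤ cross-terms
    cross-terms≥0 = 0≤x⇒0≤y⇒0≤x+y
      (0≤x⇒0≤y⇒0≤x+y (0≤x⇒0≤y⇒0≤x+y (*-nonneg s≥0 p≥0) (*-nonneg s≥0 q≥0)) (*-nonneg p≥0 q≥0))
      (*-nonneg (0≤x⇒0≤y⇒0≤x+y u≥0 u≥0) s≥0)

    split′ : parabola a′ y ≈ parabola a′ y₁ + parabola a′ y₂
    split′ = begin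
      parabola a′ y                    ≈⟨ parabola-cong a≈a′ x≈s+[p+q] ⟨
      parabola a x                     ≈⟨ split ⟩
      parabola a x₁ + parabola a x₂    ≈⟨ +-cong (parabola-cong a≈a′ x₁≈s+q)
                                                 (parabola-cong a≈a′ x₂≈s+p) ⟩
      parabola a′ y₁ + parabola a′ y₂  ∎
      where
      a≈a′ : a ≈ a′
      a≈a′ = trans a≈x+u (+-congʳ x≈s+[p+q])

    defect≈0 : y₁ * y₂ + cross-terms ≈ 0#
    defect≈0 = +-identityʳ-unique _ _ (trans
      (sym (parabola-split-defect s p q u))
      (parabola-split⇒2ax₁+2ax₂+x²≈2ax+x₁²+x₂² a′ y y₁ y₂ split′))

module PolymatroidProperties {c ℓ₁ ℓ₂ : Level} (K : OrderedField c ℓ₁ ℓ₂) {n : ℕ}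
  {f : Subset n → OrderedField.Carrier K} (polymatroid : IsPolymatroid K f) where
  open OrderedField K renaming (_≤_ to infix 4 _≤_)
  open IsTotalOrder isTotalOrder using (antisym; ≤-respʳ-≈) renaming (trans to ≤-trans)
  open IsPolymatroid polymatroid
  open OrderedFieldProperties K

  mono : ∀ {A B} → A ⊆ B → f A ≤ f B
  mono {A} A⊆B = subst (λ C → f A ≤ f C) (p⊆q⇒p∪q≡q A⊆B) (monotone A _)

  subadditive : ∀ A B → f (A ∪ B) ≤ f A + f B
  subadditive A B = ≤-trans (submod A B) (0≤y⇒x-y≤x (nonneg (A ∩ B)))

  adding-null-element : ∀ A e → f ⁅ e ⁆ ≈ 0# → f (A ∪ ⁅ e ⁆) ≈ f A
  adding-null-element A e null = antisym
    (≤-respʳ-≈ (trans (+-congˡ null) (+-identityʳ (f A))) (subadditive A ⁅ e ⁆))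
    (monotone A ⁅ e ⁆)

  flat-∉⇒f⁅e⁆≉0 : ∀ {A e} → IsFlat K (gOf K f) A → e ∉ A → f ⁅ e ⁆ ≉ 0#
  flat-∉⇒f⁅e⁆≉0 {A} {e} flat e∉A null =
    proj₂ (flat e e∉A) (sym (parabola-cong refl (adding-null-element A e null)))

  flat-disjoint⇒f≉0 : ∀ {A B} → IsFlat K (gOf K f) B → Nonempty A → A ∩ B ≡ ∅ → f A ≉ 0#
  flat-disjoint⇒f≉0 flat (e , e∈A) A∩B≡∅ fA≈0 = flat-∉⇒f⁅e⁆≉0 flat (p∩q≡∅⇒x∈p⇒x∉q A∩B≡∅ e∈A)
    (antisym (≤-respʳ-≈ fA≈0 (mono (x∈p⇒⁅x⁆⊆p e∈A))) (nonneg ⁅ e ⁆))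

proposition3p10 : ∀ {c ℓ₁ ℓ₂} (K : OrderedField c ℓ₁ ℓ₂) (n : ℕ)
    (f : Subset n → OrderedField.Carrier K) → IsPolymatroid K f →
    ∀ (F : Subset n) → IsFlat K (gOf K f) F → IsInseparable K (gOf K f) F
proposition3p10 K n f polymatroid F flat = flat , not-separable
  where
  open OrderedFieldProperties K
  open PolymatroidProperties K polymatroid

  not-separable : ¬ IsSeparable K (gOf K f) F
  not-separable (_ , F₁ , F₂ , F₁≠∅ , F₂≠∅ , F₁∩F₂≡∅ , flat₁ , flat₂ , ≡.refl , g-split) =
    x≉0⇒y≉0⇒x*y≉0
      (flat-disjoint⇒f≉0 flat₂ F₁≠∅ F₁∩F₂≡∅)
      (flat-disjoint⇒f≉0 flat₁ F₂≠∅ (≡.trans (∩-comm F₂ F₁) F₁∩F₂≡∅))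
      (parabola-split⇒*≈0 (mono (p⊆p∪q F₂)) (mono (q⊆p∪q F₁ F₂)) (subadditive F₁ F₂) (mono ⊆⊤) g-split)
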